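{- Let $d$ be a nonnegative integer and $V$ a finite set with $n=|V|\ge 2d-2$. Any algorithm for the posimodular function maximization problem for posimodular functions $f:2^V\to\{0,1,\dots,d\}$ (given a value oracle for $f$, output a nonempty subset $X\subseteq V$ maximizing $f$ together with the optimal value) requires $\Omega(n^{d-1})$ oracle calls in the worst case.
   Context: A set function $f:2^V\to\mathbb{R}$ is posimodular if $f(X)+f(Y)\ge f(X\setminus Y)+f(Y\setminus X)$ for all $X,Y\subseteq V$. The function is accessible only through an oracle returning $f(X)$ for a queried $X\subseteq V$. -}

module Defs where

open import Data.Nat using (ℕ; suc; _+_; _≤_)
open import Data.Fin using (Fin; toℕ)
open import Data.Fin.Subset using (Subset; _∩_; ∁; Nonempty)
open import Data.Product using (_×_; _,_; proj₁; proj₂)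
open import Relation.Binary.PropositionalEquality using (_≡_)

_∖_ : ∀ {n} → Subset n → Subset n → Subset n
X ∖ Y = X ∩ ∁ Y

SetFun : ℕ → ℕ → Set
SetFun n d = Subset n → Fin (suc d)

Posimodular : ∀ {n d} → SetFun n d → Set
Posimodular f = ∀ X Y → toℕ (f (X ∖ Y)) + toℕ (f (Y ∖ X)) ≤ toℕ (f X) + toℕ (f Y)

-- A (deterministic, adaptive) value-oracle algorithm: a decision tree.
data OracleAlg (n d : ℕ) : Set where
  answer : Subset n → ℕ → OracleAlg n d
  query  : Subset n → (Fin (suc d) → OracleAlg n d) → OracleAlg n d

output : ∀ {n d} → OracleAlg n d → SetFun n d → Subset n × ℕ
output (answer X v) f = X , v
output (query Q k) f = output (k (f Q)) f

calls : ∀ {n d} → OracleAlg n d → SetFun n d → ℕ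
calls (answer X v) f = 0
calls (query Q k) f = suc (calls (k (f Q)) f)

CorrectOutput : ∀ {n d} → SetFun n d → Subset n × ℕ → Set
CorrectOutput f (X , v) =
  Nonempty X × (∀ Y → Nonempty Y → toℕ (f Y) ≤ toℕ (f X)) × (v ≡ toℕ (f X))

SolvesPosimodularMax : ∀ {n d} → OracleAlg n d → Set
SolvesPosimodularMax {n} {d} A =
  (f : SetFun n d) → Posimodular f → CorrectOutput f (output A f)

-- Let d = k + 1 and f₀(X) = min(|X|, k), which is monotone, hence posimodular. For every
-- W with |V ∖ W| = k and |W| ≥ k, raising f₀ by one at the single set W keeps it
-- posimodular: the extra 1 on the left of the inequality for (X, Y) with X ∖ Y = W ≠ X
-- is absorbed by f₀(Y ∖ X) < f₀(Y), as Y ⊆ V ∖ W has at most k elements and meets X.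
-- The raised function has maximum k + 1 while f₀ has maximum k, and the two agree off W,
-- so a correct algorithm run on f₀ must query every such W. Splitting V into k blocks of
-- size q = ⌊n/k⌋ and removing one element from each block yields q^k such sets, and
-- n ≤ 2kq gives n^k ≤ (2k)^k q^k.
module Submission where

open import Defs
open import Algebra.Properties.CommutativeSemigroup using (interchange)
open import Data.Bool using (true; false; not; if_then_else_)
import Data.Bool.Properties as Bool
open import Data.Fin as Fin using (Fin; toℕ; fromℕ<; combine; finToFun; funToFin)
open import Data.Fin.Properties
  using (toℕ-fromℕ<; toℕ-injective; toℕ<n; injective⇒≤; funToFin-finToFin)
open import Data.Fin.Subset
  using (Subset; inside; outside; _∈_; _∉_; _⊆_; _∩_; ∁; ⁅_⁆; ⊥; ∣_∣; Nonempty)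
open import Data.Fin.Subset.Properties
  using (x∈p∩q⁻; p∩q⊆p; x∈∁p⇒x∉p; x∉p⇒x∈∁p; p⊆q⇒∣p∣≤∣q∣; ∣∁p∣≡n∸∣p∣; ∣⊥∣≡0; ∣⁅x⁆∣≡1;
         x∈⁅x⁆; x∈⁅y⁆⇒x≡y; nonempty?; Empty-unique)
open import Data.List using (List; []; _∷_; length; lookup)
import Data.List.Membership.DecPropositional as DecMembership
open import Data.List.Membership.Propositional using () renaming (_∈_ to _∈ₗ_; _∉_ to _∉ₗ_)
open import Data.List.Relation.Unary.Any using (here; there; index)
open import Data.List.Relation.Unary.Any.Properties using (lookup-index)
open import Data.Nat using (ℕ; zero; suc; _+_; _*_; _^_; _∸_; _⊓_; _≤_; _<_; z≤n; s≤s; z<s)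
open import Data.Nat.DivMod using (_/_; _%_; m≡m%n+[m/n]*n; m%n<n; m≥n⇒m/n>0)
open import Data.Nat.Properties hiding (_≟_)
open import Data.Nat.Tactic.RingSolver using (solve-∀)
open import Data.Product using (Σ; ∃₂; _×_; _,_; proj₁; proj₂)
open import Data.Vec using ([]; _∷_; _++_)
open import Data.Vec.Properties using (≡-dec; map-∘; map-cong; map-id; ++-injectiveˡ; ++-injectiveʳ)
open import Function using (_∘_)
open import Function.Definitions using (Injective)
open import Relation.Binary.Definitions using (DecidableEquality)
open import Relation.Binary.PropositionalEquality
open import Relation.Nullary using (¬_; Dec; yes; no; does; contradiction)
open import Relation.Nullary.Decidable using (dec-true; dec-false; decidable-stable)

infix 4 _≟_
_≟_ : ∀ {n} → DecidableEquality (Subset n)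
_≟_ = ≡-dec Bool._≟_

∁-involutive : ∀ {n} (p : Subset n) → ∁ (∁ p) ≡ p
∁-involutive p = trans (sym (map-∘ not not p)) (trans (map-cong Bool.not-involutive p) (map-id p))

∁-injective : ∀ {n} {p q : Subset n} → ∁ p ≡ ∁ q → p ≡ q
∁-injective {p = p} {q} eq = trans (sym (∁-involutive p)) (trans (cong ∁ eq) (∁-involutive q))

⁅⁆-injective : ∀ {n} {x y : Fin n} → ⁅ x ⁆ ≡ ⁅ y ⁆ → x ≡ y
⁅⁆-injective {x = x} {y} eq = x∈⁅y⁆⇒x≡y y (subst (x ∈_) eq (x∈⁅x⁆ x))

∣p++q∣≡∣p∣+∣q∣ : ∀ {m n} (p : Subset m) (q : Subset n) → ∣ p ++ q ∣ ≡ ∣ p ∣ + ∣ q ∣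
∣p++q∣≡∣p∣+∣q∣ []            q = refl
∣p++q∣≡∣p∣+∣q∣ (inside  ∷ p) q = cong suc (∣p++q∣≡∣p∣+∣q∣ p q)
∣p++q∣≡∣p∣+∣q∣ (outside ∷ p) q = ∣p++q∣≡∣p∣+∣q∣ p q

∣p∣>0⇒Nonempty : ∀ {n} {p : Subset n} → 0 < ∣ p ∣ → Nonempty p
∣p∣>0⇒Nonempty {n} {p} 0<∣p∣ with nonempty? p
... | yes p≢∅ = p≢∅
... | no  p≡∅ = contradiction (trans (cong ∣_∣ (Empty-unique p≡∅)) (∣⊥∣≡0 n)) (>⇒≢ 0<∣p∣)

Y⊆∁[X∖Y] : ∀ {n} (X Y : Subset n) → Y ⊆ ∁ (X ∖ Y)
Y⊆∁[X∖Y] X Y x∈Y = x∉p⇒x∈∁p (λ x∈X∖Y → x∈∁p⇒x∉p (proj₂ (x∈p∩q⁻ X (∁ Y) x∈X∖Y)) x∈Y)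

∖-disjoint : ∀ {n} (X Y : Subset n) {x} → x ∈ X ∖ Y → x ∉ Y ∖ X
∖-disjoint X Y x∈X∖Y x∈Y∖X =
  x∈∁p⇒x∉p (proj₂ (x∈p∩q⁻ Y (∁ X) x∈Y∖X)) (proj₁ (x∈p∩q⁻ X (∁ Y) x∈X∖Y))

X∖Y≢X⇒∣Y∖X∣<∣Y∣ : ∀ {n} (X Y : Subset n) → X ∖ Y ≢ X → ∣ Y ∖ X ∣ < ∣ Y ∣
X∖Y≢X⇒∣Y∖X∣<∣Y∣ []            []            X∖Y≢X = contradiction refl X∖Y≢X
X∖Y≢X⇒∣Y∖X∣<∣Y∣ (inside  ∷ X) (inside  ∷ Y) _     = s≤s (p⊆q⇒∣p∣≤∣q∣ (p∩q⊆p Y (∁ X)))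
X∖Y≢X⇒∣Y∖X∣<∣Y∣ (inside  ∷ X) (outside ∷ Y) X∖Y≢X =
  X∖Y≢X⇒∣Y∖X∣<∣Y∣ X Y (X∖Y≢X ∘ cong (inside ∷_))
X∖Y≢X⇒∣Y∖X∣<∣Y∣ (outside ∷ X) (inside  ∷ Y) X∖Y≢X =
  s≤s (X∖Y≢X⇒∣Y∖X∣<∣Y∣ X Y (X∖Y≢X ∘ cong (outside ∷_)))
X∖Y≢X⇒∣Y∖X∣<∣Y∣ (outside ∷ X) (outside ∷ Y) X∖Y≢X =
  X∖Y≢X⇒∣Y∖X∣<∣Y∣ X Y (X∖Y≢X ∘ cong (outside ∷_))

Posimodularℕ : ∀ {n} → (Subset n → ℕ) → Set
Posimodularℕ h = ∀ X Y → h (X ∖ Y) + h (Y ∖ X) ≤ h X + h Y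

Monotone : ∀ {n} → (Subset n → ℕ) → Set
Monotone h = ∀ {X Y} → X ⊆ Y → h X ≤ h Y

monotone⇒posimodular : ∀ {n} {h : Subset n → ℕ} → Monotone h → Posimodularℕ h
monotone⇒posimodular mono X Y = +-mono-≤ (mono (p∩q⊆p X (∁ Y))) (mono (p∩q⊆p Y (∁ X)))

toSetFun : ∀ {n d} (h : Subset n → ℕ) → (∀ X → h X ≤ d) → SetFun n d
toSetFun h h≤d X = fromℕ< (s≤s (h≤d X))

toℕ-toSetFun : ∀ {n d} (h : Subset n → ℕ) (h≤d : ∀ X → h X ≤ d) X → toℕ (toSetFun h h≤d X) ≡ h X
toℕ-toSetFun h h≤d X = toℕ-fromℕ< (s≤s (h≤d X))

toSetFun-posimodular : ∀ {n d} {h : Subset n → ℕ} (h≤d : ∀ X → h X ≤ d) →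
                       Posimodularℕ h → Posimodular (toSetFun h h≤d)
toSetFun-posimodular {h = h} h≤d pos X Y =
  subst₂ _≤_ (sym (cong₂ _+_ (value (X ∖ Y)) (value (Y ∖ X)))) (sym (cong₂ _+_ (value X) (value Y)))
    (pos X Y)
  where
  value : ∀ Z → toℕ (toSetFun h h≤d Z) ≡ h Z
  value = toℕ-toSetFun h h≤d

δ : ∀ {n} → Subset n → Subset n → ℕ
δ W X = if does (X ≟ W) then 1 else 0

δ-self : ∀ {n} (W : Subset n) → δ W W ≡ 1
δ-self W rewrite dec-true (W ≟ W) refl = refl

δ-≢ : ∀ {n} {W X : Subset n} → X ≢ W → δ W X ≡ 0
δ-≢ {W = W} {X} X≢W rewrite dec-false (X ≟ W) X≢W = refl

δ≤1 : ∀ {n} (W X : Subset n) → δ W X ≤ 1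
δ≤1 W X = if≤1 (does (X ≟ W))
  where
  if≤1 : ∀ b → (if b then 1 else 0) ≤ 1
  if≤1 true  = ≤-refl
  if≤1 false = z≤n

raiseAt : ∀ {n} → (Subset n → ℕ) → Subset n → Subset n → ℕ
raiseAt h W X = h X + δ W X

-- The only instances of posimodularity that raising at W can break.
SlackAt : ∀ {n} → (Subset n → ℕ) → Subset n → Set
SlackAt h W = ∀ X Y → X ∖ Y ≡ W → X ≢ W → h (X ∖ Y) + h (Y ∖ X) < h X + h Y

raiseAt-≢ : ∀ {n} (h : Subset n → ℕ) {W Z} → Z ≢ W → raiseAt h W Z ≡ h Z
raiseAt-≢ h Z≢W = trans (cong (h _ +_) (δ-≢ Z≢W)) (+-identityʳ _)

raiseAt-posimodular-X∖Y≡W : ∀ {n} {h : Subset n → ℕ} {W} → Posimodularℕ h → SlackAt h W →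
                            ∀ X Y → X ∖ Y ≡ W → Y ∖ X ≢ W →
                            raiseAt h W (X ∖ Y) + raiseAt h W (Y ∖ X) ≤ raiseAt h W X + raiseAt h W Y
raiseAt-posimodular-X∖Y≡W {h = h} {W} pos slack X Y X∖Y≡W Y∖X≢W = begin
  raiseAt h W (X ∖ Y) + raiseAt h W (Y ∖ X)
    ≡⟨ cong₂ _+_ (cong (λ Z → h (X ∖ Y) + δ W Z) X∖Y≡W) (raiseAt-≢ h Y∖X≢W) ⟩
  h (X ∖ Y) + δ W W + h (Y ∖ X)
    ≡⟨ cong (λ e → h (X ∖ Y) + e + h (Y ∖ X)) (δ-self W) ⟩
  h (X ∖ Y) + 1 + h (Y ∖ X)
    ≡⟨ +-suc-middle (h (X ∖ Y)) (h (Y ∖ X)) ⟩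
  suc (h (X ∖ Y) + h (Y ∖ X))
    ≤⟨ gain (X ≟ W) ⟩
  h X + δ W X + h Y
    ≤⟨ +-monoʳ-≤ (h X + δ W X) (m≤m+n (h Y) _) ⟩
  raiseAt h W X + raiseAt h W Y ∎
  where
  open ≤-Reasoning
  +-suc-middle : ∀ a b → a + 1 + b ≡ suc (a + b)
  +-suc-middle = solve-∀
  gain : Dec (X ≡ W) → suc (h (X ∖ Y) + h (Y ∖ X)) ≤ h X + δ W X + h Y
  gain (yes X≡W) = begin
    suc (h (X ∖ Y) + h (Y ∖ X)) ≤⟨ s≤s (pos X Y) ⟩
    suc (h X + h Y)             ≡⟨ +-suc-middle (h X) (h Y) ⟨
    h X + 1 + h Y               ≡⟨ cong (λ e → h X + e + h Y) (trans (cong (δ W) X≡W) (δ-self W)) ⟨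
    h X + δ W X + h Y           ∎
  gain (no X≢W) = begin
    suc (h (X ∖ Y) + h (Y ∖ X)) ≤⟨ slack X Y X∖Y≡W X≢W ⟩
    h X + h Y                   ≤⟨ +-monoˡ-≤ (h Y) (m≤m+n (h X) _) ⟩
    h X + δ W X + h Y           ∎

raiseAt-posimodular : ∀ {n} {h : Subset n → ℕ} {W} →
                      Posimodularℕ h → Nonempty W → SlackAt h W → Posimodularℕ (raiseAt h W)
raiseAt-posimodular {h = h} {W} pos (w , w∈W) slack X Y = cases (X ∖ Y ≟ W) (Y ∖ X ≟ W)
  where
  open ≤-Reasoning
  cases : Dec (X ∖ Y ≡ W) → Dec (Y ∖ X ≡ W) →
          raiseAt h W (X ∖ Y) + raiseAt h W (Y ∖ X) ≤ raiseAt h W X + raiseAt h W Y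
  cases (yes X∖Y≡W) (yes Y∖X≡W) =
    contradiction (subst (w ∈_) (sym Y∖X≡W) w∈W) (∖-disjoint X Y (subst (w ∈_) (sym X∖Y≡W) w∈W))
  cases (yes X∖Y≡W) (no Y∖X≢W) = raiseAt-posimodular-X∖Y≡W {h = h} pos slack X Y X∖Y≡W Y∖X≢W
  cases (no X∖Y≢W) (yes Y∖X≡W) =
    subst₂ _≤_ (+-comm (raiseAt h W (Y ∖ X)) _) (+-comm (raiseAt h W Y) _)
      (raiseAt-posimodular-X∖Y≡W {h = h} pos slack Y X Y∖X≡W X∖Y≢W)
  cases (no X∖Y≢W) (no Y∖X≢W) = begin
    raiseAt h W (X ∖ Y) + raiseAt h W (Y ∖ X) ≡⟨ cong₂ _+_ (raiseAt-≢ h X∖Y≢W) (raiseAt-≢ h Y∖X≢W) ⟩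
    h (X ∖ Y) + h (Y ∖ X)                     ≤⟨ pos X Y ⟩
    h X + h Y                                 ≤⟨ +-mono-≤ (m≤m+n (h X) _) (m≤m+n (h Y) _) ⟩
    raiseAt h W X + raiseAt h W Y             ∎

truncCard : ∀ {n} → ℕ → Subset n → ℕ
truncCard k X = ∣ X ∣ ⊓ k

truncCard-monotone : ∀ {n} k → Monotone (truncCard {n} k)
truncCard-monotone k X⊆Y = ⊓-monoˡ-≤ k (p⊆q⇒∣p∣≤∣q∣ X⊆Y)

-- Y ⊆ V ∖ W bounds |Y| by k, so truncation does not hide the strict loss |Y ∖ X| < |Y|.
truncCard-slack : ∀ {n} {k} {W : Subset n} → ∣ ∁ W ∣ ≡ k → SlackAt (truncCard k) W
truncCard-slack {k = k} {W} ∣∁W∣≡k X Y X∖Y≡W X≢W =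
  +-mono-≤-< (truncCard-monotone k (p∩q⊆p X (∁ Y))) (begin-strict
    ∣ Y ∖ X ∣ ⊓ k ≤⟨ m⊓n≤m _ k ⟩
    ∣ Y ∖ X ∣     <⟨ X∖Y≢X⇒∣Y∖X∣<∣Y∣ X Y (λ X∖Y≡X → X≢W (trans (sym X∖Y≡X) X∖Y≡W)) ⟩
    ∣ Y ∣         ≡⟨ m≤n⇒m⊓n≡m ∣Y∣≤k ⟨
    ∣ Y ∣ ⊓ k     ∎)
  where
  open ≤-Reasoning
  ∣Y∣≤k : ∣ Y ∣ ≤ k
  ∣Y∣≤k = subst (∣ Y ∣ ≤_) (trans (cong (∣_∣ ∘ ∁) X∖Y≡W) ∣∁W∣≡k)
            (p⊆q⇒∣p∣≤∣q∣ (Y⊆∁[X∖Y] X Y))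

truncCard≤1+k : ∀ {n} k (X : Subset n) → truncCard k X ≤ suc k
truncCard≤1+k k X = m≤n⇒m≤1+n (m⊓n≤n ∣ X ∣ k)

raisedTruncCard≤1+k : ∀ {n} k (W X : Subset n) → raiseAt (truncCard k) W X ≤ suc k
raisedTruncCard≤1+k k W X =
  subst (raiseAt (truncCard k) W X ≤_) (+-comm k 1) (+-mono-≤ (m⊓n≤n ∣ X ∣ k) (δ≤1 W X))

f₀ : ∀ {n} k → SetFun n (suc k)
f₀ k = toSetFun (truncCard k) (truncCard≤1+k k)

f₊ : ∀ {n} k → Subset n → SetFun n (suc k)
f₊ k W = toSetFun (raiseAt (truncCard k) W) (raisedTruncCard≤1+k k W)

toℕ-f₀ : ∀ {n} k (X : Subset n) → toℕ (f₀ k X) ≡ truncCard k X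
toℕ-f₀ k = toℕ-toSetFun (truncCard k) (truncCard≤1+k k)

toℕ-f₊ : ∀ {n} k (W X : Subset n) → toℕ (f₊ k W X) ≡ raiseAt (truncCard k) W X
toℕ-f₊ k W = toℕ-toSetFun (raiseAt (truncCard k) W) (raisedTruncCard≤1+k k W)

f₀-posimodular : ∀ {n} k → Posimodular (f₀ {n} k)
f₀-posimodular k =
  toSetFun-posimodular (truncCard≤1+k k) (monotone⇒posimodular (truncCard-monotone k))

f₊-posimodular : ∀ {n} k {W : Subset n} → ∣ ∁ W ∣ ≡ k → Nonempty W → Posimodular (f₊ k W)
f₊-posimodular k {W} ∣∁W∣≡k W≢∅ = toSetFun-posimodular (raisedTruncCard≤1+k k W)
  (raiseAt-posimodular {h = truncCard k}
    (monotone⇒posimodular (truncCard-monotone k)) W≢∅ (truncCard-slack ∣∁W∣≡k))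

f₀≡f₊ : ∀ {n} k {W X : Subset n} → X ≢ W → f₀ k X ≡ f₊ k W X
f₀≡f₊ k {W} {X} X≢W = toℕ-injective (begin
  toℕ (f₀ k X)              ≡⟨ toℕ-f₀ k X ⟩
  truncCard k X             ≡⟨ raiseAt-≢ (truncCard k) X≢W ⟨
  raiseAt (truncCard k) W X ≡⟨ toℕ-f₊ k W X ⟨
  toℕ (f₊ k W X)            ∎)
  where open ≡-Reasoning

f₀<f₊ : ∀ {n} k {W : Subset n} → k ≤ ∣ W ∣ → ∀ (X : Subset n) → toℕ (f₀ k X) < toℕ (f₊ k W W)
f₀<f₊ k {W} k≤∣W∣ X = begin-strict
  toℕ (f₀ k X)              ≡⟨ toℕ-f₀ k X ⟩
  ∣ X ∣ ⊓ k                 ≤⟨ m⊓n≤n ∣ X ∣ k ⟩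
  k                         <⟨ n<1+n k ⟩
  suc k                     ≡⟨ trans (cong₂ _+_ (m≥n⇒m⊓n≡n k≤∣W∣) (δ-self W)) (+-comm k 1) ⟨
  raiseAt (truncCard k) W W ≡⟨ toℕ-f₊ k W W ⟨
  toℕ (f₊ k W W)            ∎
  where open ≤-Reasoning

queries : ∀ {n d} → OracleAlg n d → SetFun n d → List (Subset n)
queries (answer X v) f = []
queries (query Q k) f = Q ∷ queries (k (f Q)) f

length-queries : ∀ {n d} (A : OracleAlg n d) f → length (queries A f) ≡ calls A f
length-queries (answer X v) f = refl
length-queries (query Q k) f = cong suc (length-queries (k (f Q)) f)

output-cong : ∀ {n d} (A : OracleAlg n d) {f g : SetFun n d} →
              (∀ {Q} → Q ∈ₗ queries A f → f Q ≡ g Q) → output A f ≡ output A g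
output-cong (answer X v) f≡g = refl
output-cong (query Q k) {f} {g} f≡g =
  trans (output-cong (k (f Q)) (f≡g ∘ there)) (cong (λ a → output (k a) g) (f≡g (here refl)))

injective-∈⇒≤length : ∀ {a} {A : Set a} {N} {xs : List A} (F : Fin N → A) →
                      Injective _≡_ _≡_ F → (∀ i → F i ∈ₗ xs) → N ≤ length xs
injective-∈⇒≤length {xs = xs} F F-injective F∈xs = injective⇒≤ index-injective
  where
  index-injective : Injective _≡_ _≡_ (index ∘ F∈xs)
  index-injective {i} {j} eq = F-injective
    (trans (lookup-index (F∈xs i)) (trans (cong (lookup xs) eq) (sym (lookup-index (F∈xs j)))))

-- Unless W is queried on f, the run on g is the same, and the answer cannot be optimal for both.
must-query : ∀ {n d} {A : OracleAlg n d} {f g : SetFun n d} {W : Subset n} →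
             SolvesPosimodularMax A → Posimodular f → Posimodular g → Nonempty W →
             (∀ {X} → X ≢ W → f X ≡ g X) → (∀ X → toℕ (f X) < toℕ (g W)) →
             W ∈ₗ queries A f
must-query {A = A} {f} {g} {W} solves f-pos g-pos W≢∅ f≡g f<gW =
  decidable-stable (DecMembership._∈?_ _≟_ W (queries A f)) W∉⇒⊥
  where
  W∉⇒⊥ : ¬ W ∉ₗ queries A f
  W∉⇒⊥ W∉ = <-irrefl refl (begin-strict
    toℕ (f X) <⟨ f<gW X ⟩
    toℕ (g W) ≤⟨ proj₁ (proj₂ correct-g) W W≢∅ ⟩
    toℕ (g X) ≡⟨ proj₂ (proj₂ correct-g) ⟨
    v         ≡⟨ proj₂ (proj₂ (solves f f-pos)) ⟩
    toℕ (f X) ∎)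
    where
    open ≤-Reasoning
    X = proj₁ (output A f)
    v = proj₂ (output A f)
    same-output : output A g ≡ output A f
    same-output = sym (output-cong A (λ Q∈ → f≡g (λ Q≡W → W∉ (subst (_∈ₗ queries A f) Q≡W Q∈))))
    correct-g : CorrectOutput g (output A f)
    correct-g = subst (CorrectOutput g) same-output (solves g g-pos)

solvable⇒0<n : ∀ {n d} {A : OracleAlg n d} → SolvesPosimodularMax A → 0 < n
solvable⇒0<n {A = A} solves with proj₁ (solves (λ _ → Fin.zero) (λ _ _ → z≤n))
... | x , _ = ≤-<-trans z≤n (toℕ<n x)

transversal : ∀ {k q} → (Fin k → Fin q) → Subset (k * q)
transversal {zero}  c = []
transversal {suc k} c = ⁅ c Fin.zero ⁆ ++ transversal (c ∘ Fin.suc)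

∣transversal∣ : ∀ {k q} (c : Fin k → Fin q) → ∣ transversal c ∣ ≡ k
∣transversal∣ {zero}  c = refl
∣transversal∣ {suc k} c =
  trans (∣p++q∣≡∣p∣+∣q∣ ⁅ c Fin.zero ⁆ _) (cong₂ _+_ (∣⁅x⁆∣≡1 (c Fin.zero)) (∣transversal∣ (c ∘ Fin.suc)))

transversal-injective : ∀ {k q} {c c′ : Fin k → Fin q} → transversal c ≡ transversal c′ → c ≗ c′
transversal-injective {suc k} {c = c} {c′} eq Fin.zero =
  ⁅⁆-injective (++-injectiveˡ ⁅ c Fin.zero ⁆ ⁅ c′ Fin.zero ⁆ eq)
transversal-injective {suc k} {c = c} {c′} eq (Fin.suc i) =
  transversal-injective (++-injectiveʳ ⁅ c Fin.zero ⁆ ⁅ c′ Fin.zero ⁆ eq) i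

funToFin-cong : ∀ {m n} {c c′ : Fin m → Fin n} → c ≗ c′ → funToFin c ≡ funToFin c′
funToFin-cong {zero}  c≗c′ = refl
funToFin-cong {suc m} c≗c′ = cong₂ combine (c≗c′ Fin.zero) (funToFin-cong (c≗c′ ∘ Fin.suc))

finToFun-injective : ∀ {m n} {i j : Fin (m ^ n)} → finToFun {m} {n} i ≗ finToFun j → i ≡ j
finToFun-injective {m} {n} {i} {j} eq = begin
  i                             ≡⟨ funToFin-finToFin {n} {m} i ⟨
  funToFin (finToFun {m} {n} i) ≡⟨ funToFin-cong eq ⟩
  funToFin (finToFun {m} {n} j) ≡⟨ funToFin-finToFin {n} {m} j ⟩
  j                             ∎
  where open ≡-Reasoning

hardSet : ∀ {k q} r → (Fin k → Fin q) → Subset (k * q + r)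
hardSet r c = ∁ (transversal c ++ ⊥ {r})

∣transversal++⊥∣ : ∀ {k q} r (c : Fin k → Fin q) → ∣ transversal c ++ ⊥ {r} ∣ ≡ k
∣transversal++⊥∣ {k} r c =
  trans (∣p++q∣≡∣p∣+∣q∣ (transversal c) ⊥)
    (trans (cong₂ _+_ (∣transversal∣ c) (∣⊥∣≡0 r)) (+-identityʳ k))

∣∁hardSet∣ : ∀ {k q} r (c : Fin k → Fin q) → ∣ ∁ (hardSet r c) ∣ ≡ k
∣∁hardSet∣ r c = trans (cong ∣_∣ (∁-involutive (transversal c ++ ⊥))) (∣transversal++⊥∣ r c)

∣hardSet∣ : ∀ {k q} r (c : Fin k → Fin q) → ∣ hardSet r c ∣ ≡ k * q + r ∸ k
∣hardSet∣ {k} {q} r c =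
  trans (∣∁p∣≡n∸∣p∣ (transversal c ++ ⊥)) (cong (k * q + r ∸_) (∣transversal++⊥∣ r c))

hardSet-injective : ∀ {k q} r {c c′ : Fin k → Fin q} → hardSet r c ≡ hardSet r c′ → c ≗ c′
hardSet-injective r {c} {c′} eq =
  transversal-injective (++-injectiveˡ (transversal c) (transversal c′) (∁-injective eq))

m+m≤n⇒m<n : ∀ {m n} → 0 < n → m + m ≤ n → m < n
m+m≤n⇒m<n {zero}  0<n _     = 0<n
m+m≤n⇒m<n {suc m} _   m+m≤n = <-≤-trans (m<m+n (suc m) z<s) m+m≤n

hardSet-queried : ∀ {k q r} {A : OracleAlg (k * q + r) (suc k)} → SolvesPosimodularMax A →
                  k + k ≤ k * q + r → (c : Fin k → Fin q) → hardSet r c ∈ₗ queries A (f₀ k)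
hardSet-queried {k} {q} {r} {A} solves 2k≤n c =
  must-query {A = A} {W = hardSet r c} solves
    (f₀-posimodular k) (f₊-posimodular k (∣∁hardSet∣ r c) W≢∅) W≢∅ (f₀≡f₊ k) (f₀<f₊ k {hardSet r c} k≤∣W∣)
  where
  k≤∣W∣ : k ≤ ∣ hardSet r c ∣
  k≤∣W∣ = subst (k ≤_) (sym (∣hardSet∣ r c)) (m+n≤o⇒m≤o∸n k 2k≤n)
  W≢∅ : Nonempty (hardSet r c)
  W≢∅ = ∣p∣>0⇒Nonempty (subst (0 <_) (sym (∣hardSet∣ r c))
          (m<n⇒0<n∸m (m+m≤n⇒m<n {k} (solvable⇒0<n {A = A} solves) 2k≤n)))

q^k≤calls : ∀ {k q r n} → n ≡ k * q + r → (A : OracleAlg n (suc k)) → SolvesPosimodularMax A →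
            k + k ≤ n → q ^ k ≤ calls A (f₀ k)
q^k≤calls {k} {q} {r} refl A solves 2k≤n = begin
  q ^ k                     ≤⟨ injective-∈⇒≤length W W-injective W-queried ⟩
  length (queries A (f₀ k)) ≡⟨ length-queries A (f₀ k) ⟩
  calls A (f₀ k)            ∎
  where
  open ≤-Reasoning
  W : Fin (q ^ k) → Subset (k * q + r)
  W = hardSet r ∘ finToFun {q} {k}
  W-injective : Injective _≡_ _≡_ W
  W-injective eq = finToFun-injective {q} {k} (hardSet-injective r eq)
  W-queried : ∀ i → W i ∈ₗ queries A (f₀ k)
  W-queried = hardSet-queried {A = A} solves 2k≤n ∘ finToFun

^-distribʳ-* : ∀ m n k → (m * n) ^ k ≡ m ^ k * n ^ k
^-distribʳ-* m n zero    = refl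
^-distribʳ-* m n (suc k) =
  trans (cong (m * n *_) (^-distribʳ-* m n k)) (interchange *-commutativeSemigroup m n (m ^ k) (n ^ k))

-- With q = ⌊n/k⌋ the remainder is below k ≤ kq, so n ≤ 2kq.
division-bound : ∀ k n → k ≤ n → ∃₂ λ q r → n ≡ k * q + r × n ^ k ≤ (2 * k) ^ k * q ^ k
division-bound zero      n _   = 0 , n , refl , ≤-refl
division-bound k@(suc _) n k≤n = q , r , n≡kq+r , (begin
  n ^ k               ≤⟨ ^-monoˡ-≤ k n≤2kq ⟩
  (2 * k * q) ^ k     ≡⟨ ^-distribʳ-* (2 * k) q k ⟩
  (2 * k) ^ k * q ^ k ∎)
  where
  open ≤-Reasoning
  q = n / k
  r = n % k
  n≡kq+r : n ≡ k * q + r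
  n≡kq+r = trans (m≡m%n+[m/n]*n n k) (trans (+-comm r (q * k)) (cong (_+ r) (*-comm q k)))
  r≤kq : r ≤ k * q
  r≤kq = ≤-trans (<⇒≤ (m%n<n n k)) (subst (_≤ k * q) (*-identityʳ k) (*-monoʳ-≤ k (m≥n⇒m/n>0 k≤n)))
  double : ∀ a b → a * b + a * b ≡ 2 * a * b
  double = solve-∀
  n≤2kq : n ≤ 2 * k * q
  n≤2kq = begin
    n             ≡⟨ n≡kq+r ⟩
    k * q + r     ≤⟨ +-monoʳ-≤ (k * q) r≤kq ⟩
    k * q + k * q ≡⟨ double k q ⟩
    2 * k * q     ∎

2[1+k]∸2≡k+k : ∀ k → 2 * suc k ∸ 2 ≡ k + k
2[1+k]∸2≡k+k k = trans (cong (_∸ 2) (*-suc 2 k)) (cong (k +_) (+-identityʳ k))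

lemma13 : (d : ℕ) → 1 ≤ d →
    Σ ℕ λ C →
      (n : ℕ) → 2 * d ∸ 2 ≤ n →
        (A : OracleAlg n d) → SolvesPosimodularMax A →
          Σ (SetFun n d) λ f → Posimodular f × (n ^ (d ∸ 1) ≤ C * calls A f)
lemma13 zero    ()
lemma13 (suc k) _ = (2 * k) ^ k , λ n 2d∸2≤n A solves →
  let 2k≤n = subst (_≤ n) (2[1+k]∸2≡k+k k) 2d∸2≤n
      q , r , n≡kq+r , n^k≤[2k]^kq^k = division-bound k n (m+n≤o⇒m≤o k 2k≤n)
  in f₀ k , f₀-posimodular k ,
     ≤-trans n^k≤[2k]^kq^k (*-monoʳ-≤ ((2 * k) ^ k) (q^k≤calls n≡kq+r A solves 2k≤n))
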